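{- Let $M_1,\dots,M_n$ be DFAs over a common alphabet $\Sigma$, and let $G$ and $H$ be the labeled graphs constructed from them as described in the context. Then $\bigcup_{i=1}^n L(M_i)=\Sigma^*$ if and only if $X_H\subseteq X_G$.
   Context: A labeled graph has finite vertex and edge sets, edges with initial/terminal vertices and labels; loops and multiple edges allowed. $X_G$ is the set of bi-infinite label sequences of bi-infinite paths in $G$. A DFA $M_i$ has a finite state set $Q_i$ (the $Q_i$ pairwise disjoint), a total transition function $\delta_i\colon Q_i\times\Sigma\to Q_i$ (viewed as a labeled graph with an edge $q\to\delta_i(q,a)$ labeled $a$), initial state $s_i$ and accepting set $F_i$; $L(M_i)=\{w\in\Sigma^*:\delta_i(s_i,w)\in F_i\}$. Let $\star,\ell,\lhd,\rhd$ be four distinct symbols not in $\Sigma$. $G$: add a vertex $t$ with a self loop labeled $\star$; add a vertex $s^*$ with a self loop labeled $a$ for each $a\in\Sigma\cup\{\ell\}$, and an edge labeled $\rhd$ from $s^*$ to $t$; for each $i$, embed $M_i$ (its states and transition edges), add for each $q\in Q_i$ an edge labeled $\lhd$ from $q$ to $s_i$ and a self loop labeled $\ell$ on $q$, and for each $q\in F_i$ an edge labeled $\rhd$ from $q$ to $t$. $H$: two vertices $q_1,q_2$; at $q_1$ self loops labeled $\lhd$, $\ell$ and each $a\in\Sigma$; an edge labeled $\rhd$ from $q_1$ to $q_2$; a self loop labeled $\star$ at $q_2$. -}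

module Defs where

open import Data.Nat using (ℕ)
open import Data.Fin using (Fin)
open import Data.Fin.Subset using (Subset; _∈_)
open import Data.Integer using (ℤ; _+_; 1ℤ)
open import Data.List using (List; foldl)
open import Data.Product using (Σ; ∃-syntax; _×_)
open import Relation.Binary.PropositionalEquality using (_≡_)

record LabeledGraph (A : Set) : Set₁ where
  field
    V     : Set
    E     : Set
    init  : E → V
    term  : E → V
    label : E → A

open LabeledGraph public

IsBiPath : {A : Set} (G : LabeledGraph A) → (ℤ → E G) → Set
IsBiPath G p = ∀ (i : ℤ) → term G (p i) ≡ init G (p (i + 1ℤ))

X : {A : Set} (G : LabeledGraph A) → (ℤ → A) → Set
X G x = ∃[ p ] (IsBiPath G p × (∀ (i : ℤ) → label G (p i) ≡ x i))

_⊆X_ : {A : Set} → LabeledGraph A → LabeledGraph A → Set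
H ⊆X G = ∀ x → X H x → X G x

record DFA (k : ℕ) : Set where
  field
    nQ : ℕ
    δ  : Fin nQ → Fin k → Fin nQ
    s  : Fin nQ
    F  : Subset nQ

open DFA public

δ* : {k : ℕ} (M : DFA k) → Fin (nQ M) → List (Fin k) → Fin (nQ M)
δ* M q w = foldl (δ M) q w

_∈L_ : {k : ℕ} → List (Fin k) → DFA k → Set
w ∈L M = δ* M (s M) w ∈ F M

data Label (k : ℕ) : Set where
  sym  : Fin k → Label k
  star : Label k
  ell  : Label k
  lhd  : Label k
  rhd  : Label k

module _ {k n : ℕ} (M : Fin n → DFA k) where

  data GV : Set where
    vt     : GV
    vs*    : GV
    vq     : (i : Fin n) → Fin (nQ (M i)) → GV

  data GE : Set where
    t-star  : GE
    s*-sym  : Fin k → GE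
    s*-ell  : GE
    s*-rhd  : GE
    q-trans : (i : Fin n) → Fin (nQ (M i)) → Fin k → GE
    q-lhd   : (i : Fin n) → Fin (nQ (M i)) → GE
    q-ell   : (i : Fin n) → Fin (nQ (M i)) → GE
    q-rhd   : (i : Fin n) (q : Fin (nQ (M i))) → q ∈ F (M i) → GE

  GInit : GE → GV
  GInit t-star          = vt
  GInit (s*-sym a)      = vs*
  GInit s*-ell          = vs*
  GInit s*-rhd          = vs*
  GInit (q-trans i q a) = vq i q
  GInit (q-lhd i q)     = vq i q
  GInit (q-ell i q)     = vq i q
  GInit (q-rhd i q _)   = vq i q

  GTerm : GE → GV
  GTerm t-star          = vt
  GTerm (s*-sym a)      = vs*
  GTerm s*-ell          = vs*
  GTerm s*-rhd          = vt
  GTerm (q-trans i q a) = vq i (δ (M i) q a)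
  GTerm (q-lhd i q)     = vq i (s (M i))
  GTerm (q-ell i q)     = vq i q
  GTerm (q-rhd i q _)   = vt

  GLabel : GE → Label k
  GLabel t-star          = star
  GLabel (s*-sym a)      = sym a
  GLabel s*-ell          = ell
  GLabel s*-rhd          = rhd
  GLabel (q-trans i q a) = sym a
  GLabel (q-lhd i q)     = lhd
  GLabel (q-ell i q)     = ell
  GLabel (q-rhd i q _)   = rhd

  graphG : LabeledGraph (Label k)
  graphG = record { V = GV ; E = GE ; init = GInit ; term = GTerm ; label = GLabel }

data HV : Set where
  q₁ q₂ : HV

module _ {k : ℕ} where

  data HE : Set where
    h-lhd  : HE
    h-ell  : HE
    h-sym  : Fin k → HE
    h-rhd  : HE
    h-star : HE

  HInit : HE → HV
  HInit h-star = q₂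
  HInit _      = q₁

  HTerm : HE → HV
  HTerm h-rhd  = q₂
  HTerm h-star = q₂
  HTerm _      = q₁

  HLabel : HE → Label k
  HLabel h-lhd     = lhd
  HLabel h-ell     = ell
  HLabel (h-sym a) = sym a
  HLabel h-rhd     = rhd
  HLabel h-star    = star

graphH : (k : ℕ) → LabeledGraph (Label k)
graphH k = record { V = HV ; E = HE {k} ; init = HInit ; term = HTerm ; label = HLabel }

-- A sequence of X_H has the shape  … ▷ ⋆ ⋆ …  with ◁, ℓ and letters of Σ before
-- the ▷ (which may also be absent).  Without a ◁ it is read in G at s* and t.
-- Otherwise, shift a ◁ to the origin: the letters between the last ◁ and the ▷
-- form a word w, and running an automaton M_i accepting w along the whole
-- sequence (◁ resets it to s_i; the left-infinite half exists by König's lemma)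
-- yields a path of G whose ▷ edge leaves an accepting state.  Conversely,
-- … ◁ ◁ w ▷ ⋆ ⋆ … lies in X_H, and in G the ▷ after w can only leave a final
-- state of the automaton entered at the last ◁.
module Submission where

open import Defs
open import Data.Nat using (ℕ)
open import Data.Fin using (Fin)
open import Data.List using (List)
open import Data.Product using (∃-syntax)
open import Function.Bundles using (_⇔_)
open import Level using (0ℓ)
open import Axiom.ExcludedMiddle using (ExcludedMiddle)

open import Axiom.DoubleNegationElimination using (em⇒dne)
open import Data.Empty using (⊥-elim)
open import Data.Fin using (zero; suc)
open import Data.Fin.Subset using (_∈_)
open import Data.Integer using (ℤ; +_; -[1+_]; 1ℤ; -_; _+_)
import Data.Integer.Properties as ℤ
open import Data.List using ([]; _∷_; _++_; [_])
open import Data.List.Properties using (foldl-++)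
open import Data.Nat using (zero; suc; _<_)
import Data.Nat as ℕ
import Data.Nat.Properties as ℕ
open import Data.Product using (_×_; _,_; proj₁; proj₂)
open import Function using (_∘_)
open import Function.Bundles using (mk⇔)
open import Relation.Binary using (tri<; tri≈; tri>)
open import Relation.Binary.PropositionalEquality
  using (_≡_; _≢_; refl; trans; cong; cong₂; subst; module ≡-Reasoning) renaming (sym to ≡-sym)
open import Relation.Nullary using (¬_; yes; no)

pos+1 : ∀ m → + m + 1ℤ ≡ + suc m
pos+1 m = cong +_ (ℕ.+-comm m 1)

module _ {A : Set} (K : LabeledGraph A) where

  IsBiPath-forward : ∀ {p} → IsBiPath K p → ∀ m → term K (p (+ m)) ≡ init K (p (+ suc m))
  IsBiPath-forward {p} bp m = trans (bp (+ m)) (cong (init K ∘ p) (pos+1 m))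

  glue : {B : Set} → (ℕ → B) → (ℕ → B) → ℤ → B
  glue l r (+ m)    = r m
  glue l r -[1+ m ] = l m

  glue-IsBiPath : (l r : ℕ → E K) →
    (∀ m → term K (l (suc m)) ≡ init K (l m)) → term K (l 0) ≡ init K (r 0) →
    (∀ m → term K (r m) ≡ init K (r (suc m))) → IsBiPath K (glue l r)
  glue-IsBiPath l r left join right (+ m) =
    trans (right m) (cong (init K ∘ glue l r) (≡-sym (pos+1 m)))
  glue-IsBiPath l r left join right -[1+ zero ] = join
  glue-IsBiPath l r left join right -[1+ suc m ] = left m

  X-cong : ∀ {x y} → (∀ z → x z ≡ y z) → X K x → X K y
  X-cong x≗y (p , bp , lp) = p , bp , λ z → trans (lp z) (x≗y z)

  X-shift : ∀ c {x} → X K x → X K (λ z → x (z + c))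
  X-shift c (p , bp , lp) = (λ z → p (z + c)) , bp′ , λ z → lp (z + c)
    where
    bp′ : IsBiPath K (λ z → p (z + c))
    bp′ z = trans (bp (z + c)) (cong (init K ∘ p) (begin
      z + c + 1ℤ   ≡⟨ ℤ.+-assoc z c 1ℤ ⟩
      z + (c + 1ℤ) ≡⟨ cong (λ c′ → z + c′) (ℤ.+-comm c 1ℤ) ⟩
      z + (1ℤ + c) ≡⟨ ℤ.+-assoc z 1ℤ c ⟨
      z + 1ℤ + c   ∎))
      where open ≡-Reasoning

  X-unshift : ∀ c {x} → X K (λ z → x (z + c)) → X K x
  X-unshift c {x} = X-cong (λ z → cong x (cancel z)) ∘ X-shift (- c)
    where
    cancel : ∀ z → z + - c + c ≡ z
    cancel z = trans (ℤ.+-assoc z (- c) c)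
                     (trans (cong (λ c′ → z + c′) (ℤ.+-inverseˡ c)) (ℤ.+-identityʳ z))

X-recentre : {A : Set} (K L : LabeledGraph A) (P : A → Set) →
  (∀ y → X K y → P (y (+ 0)) → X L y) → ∀ {x j} → X K x → P (x j) → X L x
X-recentre K L P origin {x} {j} hx pj =
  X-unshift L j (origin _ (X-shift K j hx) (subst P (cong x (≡-sym (ℤ.+-identityˡ j))) pj))

-- König's lemma

module Classical (em : ExcludedMiddle 0ℓ) where

  ¬∀⇒∃¬ : {A : Set} {P : A → Set} → ¬ (∀ a → P a) → ∃[ a ] ¬ P a
  ¬∀⇒∃¬ ¬all = em⇒dne em λ ¬ex → ¬all λ a → em⇒dne em λ ¬pa → ¬ex (a , ¬pa)

  antitone-pigeonhole : ∀ {N} (P : Fin N → ℕ → Set) →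
    (∀ r {k} e → P r (k ℕ.+ e) → P r k) → (∀ k → ∃[ r ] P r k) → ∃[ r ] ∀ k → P r k
  antitone-pigeonhole {zero}  P antitone inhabited with () ← proj₁ (inhabited 0)
  antitone-pigeonhole {suc N} P antitone inhabited with em {∀ k → P zero k}
  ... | yes always = zero , always
  -- zero fails at some depth k₀, so from k₀ on the witnesses lie among the others.
  ... | no ¬always =
    let k₀ , ¬P₀ = ¬∀⇒∃¬ ¬always
        r , deep = antitone-pigeonhole (λ r k → P (suc r) (k₀ ℕ.+ k)) (shifted k₀)
                     (beyond k₀ ¬P₀)
    in suc r , λ k → antitone (suc r) k₀ (subst (P (suc r)) (ℕ.+-comm k₀ k) (deep k))
    where
    shifted : ∀ k₀ r {k} e → P (suc r) (k₀ ℕ.+ (k ℕ.+ e)) → P (suc r) (k₀ ℕ.+ k)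
    shifted k₀ r {k} e = antitone (suc r) e ∘ subst (P (suc r)) (≡-sym (ℕ.+-assoc k₀ k e))
    beyond : ∀ k₀ → ¬ P zero k₀ → ∀ k → ∃[ r ] P (suc r) (k₀ ℕ.+ k)
    beyond k₀ ¬P₀ k with inhabited (k₀ ℕ.+ k)
    ... | zero  , p = ⊥-elim (¬P₀ (antitone zero k p))
    ... | suc r , p = r , p

  module _ {N : ℕ} where

    compose : (ℕ → Fin N → Fin N) → ℕ → Fin N → Fin N
    compose b zero    q = q
    compose b (suc k) q = b 0 (compose (b ∘ suc) k q)

    compose-+ : ∀ b k e q →
      compose b (k ℕ.+ e) q ≡ compose b k (compose (λ j → b (k ℕ.+ j)) e q)
    compose-+ b zero    e q = refl
    compose-+ b (suc k) e q = cong (b 0) (compose-+ (b ∘ suc) k e q)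

    Reachable : (ℕ → Fin N → Fin N) → ℕ → Fin N → Set
    Reachable b k p = ∃[ q ] compose b k q ≡ p

    reachable-antitone : ∀ b p {k} e → Reachable b (k ℕ.+ e) p → Reachable b k p
    reachable-antitone b p {k} e (q , q↦p) =
      compose (λ j → b (k ℕ.+ j)) e q , trans (≡-sym (compose-+ b k e q)) q↦p

    Deep : (ℕ → Fin N → Fin N) → Fin N → Set
    Deep b p = ∀ k → Reachable b k p

    deep-exists : ∀ b → Fin N → ∃[ p ] Deep b p
    deep-exists b q = antitone-pigeonhole (λ p k → Reachable b k p)
      (reachable-antitone b) (λ k → compose b k q , q , refl)

    deep-preimage : ∀ b p → Deep b p → ∃[ r ] b 0 r ≡ p × Deep (b ∘ suc) r
    deep-preimage b p deep =
      let r , deep-r = antitone-pigeonhole (λ r k → b 0 r ≡ p × Reachable (b ∘ suc) k r)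
                         antitone one-deeper
      in r , proj₁ (deep-r 0) , proj₂ ∘ deep-r
      where
      antitone : ∀ r {k} e → b 0 r ≡ p × Reachable (b ∘ suc) (k ℕ.+ e) r →
                             b 0 r ≡ p × Reachable (b ∘ suc) k r
      antitone r {k} e (r↦p , reach) = r↦p , reachable-antitone (b ∘ suc) r {k} e reach
      one-deeper : ∀ k → ∃[ r ] b 0 r ≡ p × Reachable (b ∘ suc) k r
      one-deeper k = let q , q↦p = deep (suc k) in _ , q↦p , q , refl

    orbit : ∀ b p → Deep b p → ℕ → Fin N
    orbit b p deep zero    = p
    orbit b p deep (suc j) = let r , _ , deep-r = deep-preimage b p deep in
                             orbit (b ∘ suc) r deep-r j

    orbit-step : ∀ b p deep j → b j (orbit b p deep (suc j)) ≡ orbit b p deep j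
    orbit-step b p deep zero    = proj₁ (proj₂ (deep-preimage b p deep))
    orbit-step b p deep (suc j) = let r , _ , deep-r = deep-preimage b p deep in
                                  orbit-step (b ∘ suc) r deep-r j

    bi-infinite-orbit : (f : ℤ → Fin N → Fin N) → Fin N →
      ∃[ u ] ∀ z → u (z + 1ℤ) ≡ f z (u z)
    bi-infinite-orbit f q = u , u-step
      where
      b : ℕ → Fin N → Fin N
      b j = f -[1+ j ]
      p : Fin N
      p = proj₁ (deep-exists b q)
      deep : Deep b p
      deep = proj₂ (deep-exists b q)
      v : ℕ → Fin N
      v = orbit b p deep
      u : ℤ → Fin N
      u (+ zero)  = v 0
      u (+ suc m) = f (+ m) (u (+ m))
      u -[1+ m ]  = v (suc m)
      u-step : ∀ z → u (z + 1ℤ) ≡ f z (u z)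
      u-step (+ m)          = cong u (pos+1 m)
      u-step -[1+ zero ]    = ≡-sym (orbit-step b p deep 0)
      u-step -[1+ suc m ]   = ≡-sym (orbit-step b p deep (suc m))

module _ {k : ℕ} where

  lhd-edge : (h : HE {k}) → HLabel h ≡ lhd → HInit h ≡ q₁
  lhd-edge h-lhd refl = refl

  rhd-edge : (h : HE {k}) → HLabel h ≡ rhd → HInit h ≡ q₁ × HTerm h ≡ q₂
  rhd-edge h-rhd refl = refl , refl

  into-q₁ : (h : HE {k}) → HTerm h ≡ q₁ → HInit h ≡ q₁
  into-q₁ h-lhd     _ = refl
  into-q₁ h-ell     _ = refl
  into-q₁ (h-sym a) _ = refl

  out-of-q₂ : (h : HE {k}) → HInit h ≡ q₂ → HTerm h ≡ q₂
  out-of-q₂ h-star _ = refl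

  q₁≢q₂ : q₁ ≢ q₂
  q₁≢q₂ ()

  module _ {hp : ℤ → HE {k}} (hb : IsBiPath (graphH k) hp) where

    q₁-backward : HInit (hp (+ 0)) ≡ q₁ → ∀ m → HTerm (hp -[1+ m ]) ≡ q₁
    q₁-backward start zero    = trans (hb -[1+ 0 ]) start
    q₁-backward start (suc m) = trans (hb -[1+ suc m ]) (into-q₁ _ (q₁-backward start m))

    q₂-forward : ∀ {j} → HInit (hp (+ j)) ≡ q₂ → ∀ d → HInit (hp (+ (d ℕ.+ j))) ≡ q₂
    q₂-forward start zero    = start
    q₂-forward start (suc d) =
      trans (≡-sym (IsBiPath-forward (graphH k) hb _)) (out-of-q₂ _ (q₂-forward start d))

    q₂-after-rhd : ∀ {m} → HLabel (hp (+ m)) ≡ rhd → HInit (hp (+ suc m)) ≡ q₂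
    q₂-after-rhd {m} rhd-m =
      trans (≡-sym (IsBiPath-forward (graphH k) hb m)) (proj₂ (rhd-edge _ rhd-m))

    rhd-not-after-rhd : ∀ {m r} → HLabel (hp (+ m)) ≡ rhd → m < r → HLabel (hp (+ r)) ≢ rhd
    rhd-not-after-rhd {m} {r} rhd-m m<r rhd-r =
      let o , m+o≡r = ℕ.m≤n⇒∃[o]m+o≡n m<r in
      q₁≢q₂ (trans (≡-sym (proj₁ (rhd-edge _ rhd-r)))
                   (subst (λ j → HInit (hp (+ j)) ≡ q₂) (trans (ℕ.+-comm o (suc m)) m+o≡r)
                          (q₂-forward (q₂-after-rhd rhd-m) o)))

    no-rhd-before-lhd : HLabel (hp (+ 0)) ≡ lhd → ∀ m → HLabel (hp -[1+ m ]) ≢ rhd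
    no-rhd-before-lhd lhd-0 m rhd-m =
      q₁≢q₂ (trans (≡-sym (q₁-backward (lhd-edge _ lhd-0) m)) (proj₂ (rhd-edge _ rhd-m)))

    rhd-unique : ∀ {m r} → HLabel (hp (+ m)) ≡ rhd → HLabel (hp (+ r)) ≡ rhd → m ≡ r
    rhd-unique {m} {r} rhd-m rhd-r with ℕ.<-cmp m r
    ... | tri< m<r _ _ = ⊥-elim (rhd-not-after-rhd rhd-m m<r rhd-r)
    ... | tri≈ _ m≡r _ = m≡r
    ... | tri> _ _ r<m = ⊥-elim (rhd-not-after-rhd rhd-r r<m rhd-m)

  wordEdge : List (Fin k) → ℕ → HE {k}
  wordEdge []      zero    = h-rhd
  wordEdge []      (suc m) = h-star
  wordEdge (a ∷ w) zero    = h-sym a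
  wordEdge (a ∷ w) (suc m) = wordEdge w m

  wordEdge-init : ∀ w → HInit (wordEdge w 0) ≡ q₁
  wordEdge-init []      = refl
  wordEdge-init (a ∷ w) = refl

  wordEdge-ray : ∀ w m → HTerm (wordEdge w m) ≡ HInit (wordEdge w (suc m))
  wordEdge-ray []      zero    = refl
  wordEdge-ray []      (suc m) = refl
  wordEdge-ray (a ∷ w) zero    = ≡-sym (wordEdge-init w)
  wordEdge-ray (a ∷ w) (suc m) = wordEdge-ray w m

  wordPath : List (Fin k) → ℤ → HE {k}
  wordPath w = glue (graphH k) (λ _ → h-lhd) (wordEdge w)

  wordPath-X : ∀ w → X (graphH k) (HLabel ∘ wordPath w)
  wordPath-X w = wordPath w ,
    glue-IsBiPath (graphH k) _ _ (λ _ → refl) (≡-sym (wordEdge-init w)) (wordEdge-ray w) ,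
    λ _ → refl

readLabel : ∀ {k} → List (Fin k) → Label k → List (Fin k)
readLabel w (sym a) = w ++ [ a ]
readLabel w lhd     = []
readLabel w ell     = w
readLabel w rhd     = w
readLabel w star    = w

-- The Σ-word read in positions 0, …, m-1 since the last ◁.
wordRead : ∀ {k} → (ℕ → Label k) → ℕ → List (Fin k)
wordRead y zero    = []
wordRead y (suc m) = readLabel (wordRead y m) (y m)

module _ {k : ℕ} (D : DFA k) where

  -- The move of D along the G-edge labelled l; the values at ▷ and ⋆ are never
  -- used, those edges leave the automaton.
  step : Label k → Fin (nQ D) → Fin (nQ D)
  step (sym a) q = δ D q a
  step lhd     q = s D
  step ell     q = q
  step rhd     q = q
  step star    q = q

  step-δ* : ∀ w l → step l (δ* D (s D) w) ≡ δ* D (s D) (readLabel w l)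
  step-δ* w (sym a) = ≡-sym (foldl-++ (δ D) (s D) w [ a ])
  step-δ* w lhd     = refl
  step-δ* w ell     = refl
  step-δ* w rhd     = refl
  step-δ* w star    = refl

  run-reads-word : ∀ (y : ℕ → Label k) (u : ℕ → Fin (nQ D)) →
    (∀ m → u (suc m) ≡ step (y m) (u m)) → y 0 ≡ lhd →
    ∀ m → u (suc m) ≡ δ* D (s D) (wordRead y (suc m))
  run-reads-word y u run y0 zero = begin
    u 1                              ≡⟨ run 0 ⟩
    step (y 0) (u 0)                 ≡⟨ cong (λ l → step l (u 0)) y0 ⟩
    s D                              ≡⟨ cong (λ l → δ* D (s D) (readLabel [] l)) y0 ⟨
    δ* D (s D) (readLabel [] (y 0))  ∎
    where open ≡-Reasoning
  run-reads-word y u run y0 (suc m) = begin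
    u (suc (suc m))                                    ≡⟨ run (suc m) ⟩
    step (y (suc m)) (u (suc m))                       ≡⟨ cong (step (y (suc m)))
                                                               (run-reads-word y u run y0 m) ⟩
    step (y (suc m)) (δ* D (s D) (wordRead y (suc m))) ≡⟨ step-δ* _ (y (suc m)) ⟩
    δ* D (s D) (wordRead y (suc (suc m)))              ∎
    where open ≡-Reasoning

module _ {k n : ℕ} (M : Fin n → DFA k) where

  Covers : Set
  Covers = ∀ (w : List (Fin k)) → ∃[ i ] (w ∈L M i)

  module _ (i : Fin n) where

    -- Along a run of M i, the vertex q₁ of H is simulated by the current state
    -- and q₂ by t.
    shadow : HV → Fin (nQ (M i)) → GV M
    shadow q₁ q = vq i q
    shadow q₂ q = vt

    shadowEdge : (h : HE {k}) (q : Fin (nQ (M i))) → (HLabel h ≡ rhd → q ∈ F (M i)) → GE M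
    shadowEdge h-lhd     q _      = q-lhd i q
    shadowEdge h-ell     q _      = q-ell i q
    shadowEdge (h-sym a) q _      = q-trans i q a
    shadowEdge h-rhd     q accept = q-rhd i q (accept refl)
    shadowEdge h-star    q _      = t-star

    shadowEdge-init : ∀ h q accept → GInit M (shadowEdge h q accept) ≡ shadow (HInit h) q
    shadowEdge-init h-lhd     q _ = refl
    shadowEdge-init h-ell     q _ = refl
    shadowEdge-init (h-sym a) q _ = refl
    shadowEdge-init h-rhd     q _ = refl
    shadowEdge-init h-star    q _ = refl

    shadowEdge-term : ∀ h q accept →
      GTerm M (shadowEdge h q accept) ≡ shadow (HTerm h) (step (M i) (HLabel h) q)
    shadowEdge-term h-lhd     q _ = refl
    shadowEdge-term h-ell     q _ = refl
    shadowEdge-term (h-sym a) q _ = refl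
    shadowEdge-term h-rhd     q _ = refl
    shadowEdge-term h-star    q _ = refl

    shadowEdge-label : ∀ h q accept → GLabel M (shadowEdge h q accept) ≡ HLabel h
    shadowEdge-label h-lhd     q _ = refl
    shadowEdge-label h-ell     q _ = refl
    shadowEdge-label (h-sym a) q _ = refl
    shadowEdge-label h-rhd     q _ = refl
    shadowEdge-label h-star    q _ = refl

    X-from-run : ∀ {x} → X (graphH k) x → (u : ℤ → Fin (nQ (M i))) →
      (∀ z → u (z + 1ℤ) ≡ step (M i) (x z) (u z)) → (∀ z → x z ≡ rhd → u z ∈ F (M i)) →
      X (graphG M) x
    X-from-run {x} (hp , hb , lp) u run accepting =
      p , bp , λ z → trans (shadowEdge-label _ _ _) (lp z)
      where
      p : ℤ → GE M
      p z = shadowEdge (hp z) (u z) (accepting z ∘ trans (≡-sym (lp z)))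
      bp : IsBiPath (graphG M) p
      bp z = begin
        GTerm M (p z)
          ≡⟨ shadowEdge-term (hp z) (u z) _ ⟩
        shadow (HTerm (hp z)) (step (M i) (HLabel (hp z)) (u z))
          ≡⟨ cong₂ shadow (hb z) (trans (cong (λ l → step (M i) l (u z)) (lp z)) (≡-sym (run z))) ⟩
        shadow (HInit (hp (z + 1ℤ))) (u (z + 1ℤ))
          ≡⟨ shadowEdge-init _ _ _ ⟨
        GInit M (p (z + 1ℤ))
          ∎
        where open ≡-Reasoning

  collapse : HV → GV M
  collapse q₁ = vs*
  collapse q₂ = vt

  -- ◁ has no counterpart at s*, so it is sent to the ℓ loop.
  collapseEdge : HE {k} → GE M
  collapseEdge h-lhd     = s*-ell
  collapseEdge h-ell     = s*-ell
  collapseEdge (h-sym a) = s*-sym a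
  collapseEdge h-rhd     = s*-rhd
  collapseEdge h-star    = t-star

  collapseEdge-init : ∀ h → GInit M (collapseEdge h) ≡ collapse (HInit h)
  collapseEdge-init h-lhd     = refl
  collapseEdge-init h-ell     = refl
  collapseEdge-init (h-sym a) = refl
  collapseEdge-init h-rhd     = refl
  collapseEdge-init h-star    = refl

  collapseEdge-term : ∀ h → GTerm M (collapseEdge h) ≡ collapse (HTerm h)
  collapseEdge-term h-lhd     = refl
  collapseEdge-term h-ell     = refl
  collapseEdge-term (h-sym a) = refl
  collapseEdge-term h-rhd     = refl
  collapseEdge-term h-star    = refl

  collapseEdge-label : ∀ h → HLabel h ≢ lhd → GLabel M (collapseEdge h) ≡ HLabel h
  collapseEdge-label h-lhd     h≢lhd = ⊥-elim (h≢lhd refl)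
  collapseEdge-label h-ell     _     = refl
  collapseEdge-label (h-sym a) _     = refl
  collapseEdge-label h-rhd     _     = refl
  collapseEdge-label h-star    _     = refl

  X-without-lhd : ∀ {x} → X (graphH k) x → (∀ z → x z ≢ lhd) → X (graphG M) x
  X-without-lhd (hp , hb , lp) no-lhd =
    collapseEdge ∘ hp ,
    (λ z → trans (collapseEdge-term (hp z))
                 (trans (cong collapse (hb z)) (≡-sym (collapseEdge-init (hp (z + 1ℤ)))))) ,
    (λ z → trans (collapseEdge-label (hp z) (no-lhd z ∘ trans (≡-sym (lp z)))) (lp z))

  lhd-resets : (e : GE M) → GLabel M e ≡ lhd → ∃[ i ] GTerm M e ≡ vq i (s (M i))
  lhd-resets (q-lhd i q) refl = i , refl

  sym-steps : ∀ {i q a} (e : GE M) → GInit M e ≡ vq i q → GLabel M e ≡ sym a →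
    GTerm M e ≡ vq i (δ (M i) q a)
  sym-steps (q-trans i q a) refl refl = refl

  rhd-accepts : ∀ {i q} (e : GE M) → GInit M e ≡ vq i q → GLabel M e ≡ rhd → q ∈ F (M i)
  rhd-accepts (q-rhd i q q∈F) refl refl = q∈F

  reads-then-accepts : ∀ {i} (p : ℕ → GE M) → (∀ m → GTerm M (p m) ≡ GInit M (p (suc m))) →
    ∀ w {q} → GInit M (p 0) ≡ vq i q → (∀ m → GLabel M (p m) ≡ HLabel (wordEdge w m)) →
    δ* (M i) q w ∈ F (M i)
  reads-then-accepts p ray []      start labels = rhd-accepts (p 0) start (labels 0)
  reads-then-accepts p ray (a ∷ w) start labels =
    reads-then-accepts (p ∘ suc) (ray ∘ suc) w
      (trans (≡-sym (ray 0)) (sym-steps (p 0) start (labels 0))) (labels ∘ suc)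

  ⊆X⇒covers : graphH k ⊆X graphG M → Covers
  ⊆X⇒covers H⊆G w =
    let p , bp , lp = H⊆G _ (wordPath-X w)
        i , reset = lhd-resets (p -[1+ 0 ]) (lp -[1+ 0 ])
    in i , reads-then-accepts (p ∘ +_) (IsBiPath-forward (graphG M) bp) w
             (trans (≡-sym (bp -[1+ 0 ])) reset) (lp ∘ +_)

  module _ (em : ExcludedMiddle 0ℓ) (cover : Covers) where

    Accepts : Fin n → (ℤ → Label k) → Set
    Accepts i x = ∀ m → x (+ m) ≡ rhd → wordRead (x ∘ +_) m ∈L M i

    accepting-index : ∀ {x} → X (graphH k) x → ∃[ i ] Accepts i x
    accepting-index {x} (hp , hb , lp) with em {∃[ r ] x (+ r) ≡ rhd}
    ... | yes (r , xr) = let i , w∈L = cover (wordRead (x ∘ +_) r) in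
      i , λ m xm → subst (λ j → wordRead (x ∘ +_) j ∈L M i)
                         (≡-sym (rhd-unique hb (trans (lp _) xm) (trans (lp _) xr))) w∈L
    ... | no no-rhd = proj₁ (cover []) , λ m xm → ⊥-elim (no-rhd (m , xm))

    accepting-run : ∀ {x} → X (graphH k) x → x (+ 0) ≡ lhd → ∀ {i} → Accepts i x →
      (u : ℤ → Fin (nQ (M i))) → (∀ z → u (z + 1ℤ) ≡ step (M i) (x z) (u z)) →
      ∀ z → x z ≡ rhd → u z ∈ F (M i)
    accepting-run _ x0 _ _ _ (+ zero) x0≡rhd with () ← trans (≡-sym x0) x0≡rhd
    accepting-run {x} _ x0 {i} accepts u run (+ suc m) xm =
      subst (_∈ F (M i)) (≡-sym (run-reads-word (M i) (x ∘ +_) (u ∘ +_) run⁺ x0 m))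
            (accepts (suc m) xm)
      where
      run⁺ : ∀ m → u (+ suc m) ≡ step (M i) (x (+ m)) (u (+ m))
      run⁺ m = trans (cong u (≡-sym (pos+1 m))) (run (+ m))
    accepting-run (hp , hb , lp) x0 _ _ _ -[1+ m ] xm =
      ⊥-elim (no-rhd-before-lhd hb (trans (lp _) x0) m (trans (lp _) xm))

    X-from-lhd-at-origin : ∀ x → X (graphH k) x → x (+ 0) ≡ lhd → X (graphG M) x
    X-from-lhd-at-origin x hx x0 =
      let i , accepts = accepting-index hx
          u , run = Classical.bi-infinite-orbit em (λ z → step (M i) (x z)) (s (M i))
      in X-from-run i hx u run (accepting-run hx x0 accepts u run)

theorem4p13 : ExcludedMiddle 0ℓ →
    (k n : ℕ) (M : Fin n → DFA k) →
    ((∀ (w : List (Fin k)) → ∃[ i ] (w ∈L M i)) ⇔ (graphH k ⊆X graphG M))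
theorem4p13 em k n M = mk⇔ covers⇒⊆X (⊆X⇒covers M)
  where
  covers⇒⊆X : Covers M → graphH k ⊆X graphG M
  covers⇒⊆X cover x hx with em {∃[ j ] x j ≡ lhd}
  ... | yes (j , xj) =
    X-recentre (graphH k) (graphG M) (_≡ lhd) (X-from-lhd-at-origin M em cover) hx xj
  ... | no no-lhd    = X-without-lhd M hx (λ z xz → no-lhd (z , xz))
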